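{- Let $G$ be a group and let $\mathcal{B}$ be a left-invariant Boolean algebra with $\mathcal{B}\subseteq\mathcal{B}^{\mathrm{st}}_G$. Fix $A\in\mathcal{B}$ and, for $p\in S(\mathcal{B}^\sharp)$, set $dp^*(A)=\{x\in G:Ax^{ -1}\in p\}$. Then: \begin{enumerate} \item[(a)] if $p\in S(\mathcal{B})$ then $dp(A)\in\mathcal{B}^\sharp$; \item[(b)] if $p\in S(\mathcal{B}^\sharp)$ then $dp^*(A)\in\mathcal{B}$; \item[(c)] if $p\in S(\mathcal{B}^\sharp)$ and $q\in S(\mathcal{B})$, then $dq(A)\in p$ if and only if $dp^*(A)\in q$. \end{enumerate}
   Context: $A\subseteq G$ is stable in $G$ if there do not exist an infinite linear order $I$ and sequences $(a_i)_{i\in I},(b_i)_{i\in I}$ in $G$ with $a_ib_j\in A$ iff $i\le j$; $\mathcal{B}^{\mathrm{st}}_G$ is the set of all subsets of $G$ stable in $G$. A Boolean algebra $\mathcal{B}\subseteq\mathcal{P}(G)$ is left-invariant if $gA\in\mathcal{B}$ for $g\in G,A\in\mathcal{B}$; bi-invariant if also $Ag\in\mathcal{B}$. $\mathcal{B}^\sharp$ is the smallest bi-invariant Boolean algebra containing $\mathcal{B}$. For a Boolean algebra $\mathcal{C}$ of subsets of $G$, a $\mathcal{C}$-type is a set $p\subseteq\mathcal{C}$ with $\emptyset\notin p$, closed under finite intersections, such that for each $A\in\mathcal{C}$ either $A\in p$ or $G\setminus A\in p$; $S(\mathcal{C})$ is the set of $\mathcal{C}$-types. For $p\in S(\mathcal{B})$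 and $A\in\mathcal{B}$, $dp(A)=\{x\in G:x^{ -1}A\in p\}$. -}

module Defs where

open import Level using (0ℓ) renaming (suc to lsuc)
open import Data.Bool using (Bool; true; false; not; _∧_)
open import Data.Nat using (ℕ)
open import Data.Fin using (Fin)
open import Data.Product using (Σ; _×_; _,_)
open import Data.Sum using (_⊎_)
open import Relation.Nullary using (¬_)
open import Relation.Binary using (Rel; IsTotalOrder)
open import Relation.Binary.PropositionalEquality using (_≡_; _≗_)
open import Algebra.Core using (Op₁; Op₂)
open import Algebra.Structures using (IsGroup)
open import Function.Bundles using (_⇔_; _↔_)

record PGroup : Set₁ where
  infixl 7 _∙_
  field
    Carrier : Set
    _∙_     : Op₂ Carrier
    ε       : Carrier
    _⁻¹     : Op₁ Carrier
    isGroup : IsGroup _≡_ _∙_ ε _⁻¹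

module _ (𝔾 : PGroup) where
  open PGroup 𝔾 renaming (Carrier to G)

  -- Subsets of G, as characteristic functions.  Two subsets are equal
  -- iff they are pointwise equal (_≗_).
  Subset : Set
  Subset = G → Bool

  Family : Set₂
  Family = Subset → Set₁

  ∅ : Subset
  ∅ _ = false

  ∁ : Subset → Subset
  ∁ A x = not (A x)

  _∩_ : Subset → Subset → Subset
  (A ∩ B) x = A x ∧ B x

  -- left translate gA = {g y : y ∈ A}
  _·ˡ_ : G → Subset → Subset
  (g ·ˡ A) x = A ((g ⁻¹) ∙ x)

  -- right translate Ag = {y g : y ∈ A}
  _·ʳ_ : Subset → G → Subset
  (A ·ʳ g) x = A (x ∙ (g ⁻¹))

  Represents : Subset → (G → Set₁) → Set₁
  Represents D P = ∀ x → (D x ≡ true) ⇔ P x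

  Infinite : Set → Set
  Infinite I = ¬ (Σ ℕ λ n → I ↔ Fin n)

  Ladder : Subset → Set₁
  Ladder A =
    Σ Set λ I → Σ (Rel I 0ℓ) λ _≤_ → IsTotalOrder _≡_ _≤_ × Infinite I ×
    Σ (I → G) λ a → Σ (I → G) λ b →
      ∀ i j → (A (a i ∙ b j) ≡ true) ⇔ (i ≤ j)

  Stable : Subset → Set₁
  Stable A = ¬ Ladder A

  record IsBooleanAlgebra (𝓑 : Family) : Set₁ where
    field
      ba-ext   : ∀ {A B} → 𝓑 A → A ≗ B → 𝓑 B
      ba-empty : 𝓑 ∅
      ba-compl : ∀ {A} → 𝓑 A → 𝓑 (∁ A)
      ba-inter : ∀ {A B} → 𝓑 A → 𝓑 B → 𝓑 (A ∩ B)

  LeftInvariant : Family → Set₁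
  LeftInvariant 𝓑 = ∀ g {A} → 𝓑 A → 𝓑 (g ·ˡ A)

  RightInvariant : Family → Set₁
  RightInvariant 𝓑 = ∀ g {A} → 𝓑 A → 𝓑 (A ·ʳ g)

  -- 𝓑♯ : smallest bi-invariant Boolean algebra containing 𝓑,
  -- given as the inductively generated closure.
  data Sharp (𝓑 : Family) : Family where
    base  : ∀ {A} → 𝓑 A → Sharp 𝓑 A
    ext   : ∀ {A B} → Sharp 𝓑 A → A ≗ B → Sharp 𝓑 B
    empty : Sharp 𝓑 ∅
    compl : ∀ {A} → Sharp 𝓑 A → Sharp 𝓑 (∁ A)
    inter : ∀ {A B} → Sharp 𝓑 A → Sharp 𝓑 B → Sharp 𝓑 (A ∩ B)
    left  : ∀ g {A} → Sharp 𝓑 A → Sharp 𝓑 (g ·ˡ A)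
    right : ∀ g {A} → Sharp 𝓑 A → Sharp 𝓑 (A ·ʳ g)

  record IsType (𝓒 : Family) (p : Family) : Set₁ where
    field
      ty-ext   : ∀ {A B} → p A → A ≗ B → p B
      ty-sub   : ∀ {A} → p A → 𝓒 A
      ty-nonempty : ¬ p ∅
      ty-inter : ∀ {A B} → p A → p B → p (A ∩ B)
      ty-complete : ∀ {A} → 𝓒 A → p A ⊎ p (∁ A)

  d : Family → Subset → G → Set₁
  d p A x = p ((x ⁻¹) ·ˡ A)

  d* : Family → Subset → G → Set₁
  d* p A x = p (A ·ʳ (x ⁻¹))

module Submission where

-- Everything rests on a relation R : X → Y → Bool such that
-- neither R nor its complement has a ladder (an infinite half-graph).
-- (1) finiteSupport: if a filter base P decides every row R x, membership
--     of rows in P depends only on finitely many columns; otherwise a stagewise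
--     choice yields twin rows, split above the diagonal and equal below it, and
--     Ramsey's theorem for pairs turns them into a ladder (twinsLadder).
-- (2) invariant⇒combination: such a set of rows is a Boolean combination of
--     columns.  (1) and (2) give `definable`.
-- (3) CrossedLadder: rows and columns picked alternately from two filter bases
--     that disagree about R form a ladder.
-- For the theorem, R x y = A(xy) has left translates of A as rows and right
-- translates as columns, and its ladders contradict stability of A or ∁A.
-- Parts (a) and (b) are instances of `definable` (for R and its transpose),
-- part (c) of (3).

open import Defs
import Level
open Level using (0ℓ; lift; lower)
open import Axiom.ExcludedMiddle using (ExcludedMiddle)
open import Axiom.DoubleNegationElimination using (em⇒dne)
open import Data.Bool using (Bool; true; false; not; _∧_; _∨_)
open import Data.Bool.Properties
  using (¬-not; not-¬; not-injective; not-involutive; ∧-conicalˡ; ∧-conicalʳ; ∨-identityʳ)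
open import Data.Empty using (⊥; ⊥-elim)
open import Data.Fin using (Fin; toℕ)
open import Data.Fin.Properties using (pigeonhole)
open import Data.List using (List; []; _∷_)
open import Data.List.Relation.Unary.All as All using (All; []; _∷_)
open import Data.Nat using (ℕ; zero; suc; _≤_; _<_; _⊔_; _≤′_; ≤′-refl; ≤′-step; s≤s; _≤?_)
open import Data.Nat.Properties
  using (≤⇒≤′; ≤-refl; ≤-trans; <-trans; <⇒≤; m≤m⊔n; m≤n⊔m; m≤n⇒m<n∨m≡n; ≰⇒>; n<1+n; <-irrefl; ≤-isTotalOrder)
open import Data.Product using (Σ; _×_; _,_; proj₁; proj₂)
open import Data.Sum using (_⊎_; inj₁; inj₂)
open import Data.Unit using (⊤; tt)
open import Function using (flip; _∘_)
open import Function.Bundles using (_⇔_; mk⇔; Equivalence; Injection; _↔_; _↣_)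
import Function.Properties.Equivalence as ⇔
open import Function.Properties.Inverse using (↔⇒↣)
open import Relation.Binary.Core using (_Preserves_⟶_)
open import Relation.Binary.PropositionalEquality using (_≡_; refl; sym; trans; cong; _≗_)
import Relation.Binary.Construct.Flip.EqAndOrd as Flip
open import Relation.Nullary using (¬_; Dec; yes; no)
open import Relation.Nullary.Decidable using (map′; isYes; decidable-stable)
open import Algebra.Properties.Group using (⁻¹-involutive)

bool-ext : ∀ {a b : Bool} → (a ≡ true → b ≡ true) → (b ≡ true → a ≡ true) → a ≡ b
bool-ext {true}  {true}  _ _ = refl
bool-ext {true}  {false} f _ = sym (f refl)
bool-ext {false} {true}  _ g = g refl
bool-ext {false} {false} _ _ = refl

∧-true : ∀ a b → a ∧ b ≡ true → a ≡ true × b ≡ true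
∧-true a b e = ∧-conicalˡ a b e , ∧-conicalʳ a b e

∨-via-∧ : ∀ a b → not (not a ∧ not b) ≡ a ∨ b
∨-via-∧ true  b = refl
∨-via-∧ false b = not-involutive b

isYes⇔ : ∀ {a} {P : Set a} (d : Dec P) → (isYes d ≡ true) ⇔ P
isYes⇔ (yes p) = mk⇔ (λ _ → p) (λ _ → refl)
isYes⇔ (no ¬p) = mk⇔ (λ ()) (λ p → ⊥-elim (¬p p))

antitone : {X : Set} (S : ℕ → X → Set) → (∀ k {x} → S (suc k) x → S k x) →
           ∀ {i j} → i ≤ j → ∀ {x} → S j x → S i x
antitone S shrink i≤j = go (≤⇒≤′ i≤j)
  where
  go : ∀ {i j} → i ≤′ j → ∀ {x} → S j x → S i x
  go ≤′-refl      s = s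
  go (≤′-step i≤j) s = go i≤j (shrink _ s)

stepwise-increasing : (g : ℕ → ℕ) → (∀ k → g k < g (suc k)) → g Preserves _<_ ⟶ _<_
stepwise-increasing g step i<j = go (≤⇒≤′ i<j)
  where
  go : ∀ {i j} → suc i ≤′ j → g i < g j
  go ≤′-refl       = step _
  go (≤′-step i<j) = <-trans (go i<j) (step _)

increasing⇒monotone : {g : ℕ → ℕ} → g Preserves _<_ ⟶ _<_ → g Preserves _≤_ ⟶ _≤_
increasing⇒monotone mono i≤j with m≤n⇒m<n∨m≡n i≤j
... | inj₁ i<j  = <⇒≤ (mono i<j)
... | inj₂ refl = ≤-refl

Unbounded : (ℕ → Set) → Set
Unbounded S = ∀ m → Σ ℕ λ n → m ≤ n × S n

enumerate : {S : ℕ → Set} → Unbounded S →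
            Σ (ℕ → ℕ) λ g → g Preserves _<_ ⟶ _<_ × (∀ k → S (g k))
enumerate {S} unbounded = g , stepwise-increasing g step , inS
  where
  g : ℕ → ℕ
  g zero    = proj₁ (unbounded 0)
  g (suc k) = proj₁ (unbounded (suc (g k)))

  step : ∀ k → g k < g (suc k)
  step k = proj₁ (proj₂ (unbounded (suc (g k))))

  inS : ∀ k → S (g k)
  inS zero    = proj₂ (proj₂ (unbounded 0))
  inS (suc k) = proj₂ (proj₂ (unbounded (suc (g k))))

-- ℕ is infinite: an injection ℕ → Fin n already collides on 0, …, n.
ℕ-infinite : ¬ (Σ ℕ λ n → ℕ ↔ Fin n)
ℕ-infinite (n , ℕ↔Fin) =
  let (i , j , i<j , collide) = pigeonhole (n<1+n n) (Injection.to ℕ↣Fin ∘ toℕ)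
  in <-irrefl (Injection.injective ℕ↣Fin collide) i<j
  where
  ℕ↣Fin : ℕ ↣ Fin n
  ℕ↣Fin = ↔⇒↣ ℕ↔Fin

Agree : {X Y : Set} → (X → Y → Bool) → List Y → X → X → Set
Agree R F x x' = All (λ y → R x y ≡ R x' y) F

agree-refl : {X Y : Set} (R : X → Y → Bool) (F : List Y) (x : X) → Agree R F x x
agree-refl R F x = All.universal (λ _ → refl) F

agree-sym : {X Y : Set} (R : X → Y → Bool) {F : List Y} {x x' : X} → Agree R F x x' → Agree R F x' x
agree-sym R = All.map sym

agree-trans : {X Y : Set} (R : X → Y → Bool) {F : List Y} {x x' x'' : X} →
              Agree R F x x' → Agree R F x' x'' → Agree R F x x''
agree-trans R a a' = All.zipWith (λ (e , e') → trans e e') (a , a')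

record ℕLadder {X Y : Set} (R : X → Y → Bool) : Set where
  field
    row   : ℕ → X
    col   : ℕ → Y
    above : ∀ {k n} → k ≤ n → R (row k) (col n) ≡ true
    below : ∀ {k n} → n < k → R (row k) (col n) ≡ false

  pattern-iff : ∀ k n → (R (row k) (col n) ≡ true) ⇔ (k ≤ n)
  pattern-iff k n = mk⇔ onlyAbove above
    where
    onlyAbove : R (row k) (col n) ≡ true → k ≤ n
    onlyAbove e with k ≤? n
    ... | yes k≤n = k≤n
    ... | no k≰n with trans (sym e) (below (≰⇒> k≰n))
    ...   | ()

NoLadder : {X Y : Set} → (X → Y → Bool) → Set
NoLadder R = ¬ ℕLadder R × ¬ ℕLadder (λ x y → not (R x y))

record IsFilterBase {Y : Set} (P : (Y → Bool) → Set₁) : Set₁ where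
  field
    full    : P (λ _ → true)
    meet    : ∀ {S S'} → P S → P S' → P (λ y → S y ∧ S' y)
    witness : ∀ {S} → P S → Σ Y λ y → S y ≡ true

record IsFieldOfSets {X : Set} (C : (X → Bool) → Set₁) : Set₁ where
  field
    C-ext   : ∀ {S S'} → C S → S ≗ S' → C S'
    C-empty : C (λ _ → false)
    C-compl : ∀ {S} → C S → C (λ x → not (S x))
    C-inter : ∀ {S S'} → C S → C S' → C (λ x → S x ∧ S' x)

  C-union : ∀ {S S'} → C S → C S' → C (λ x → S x ∨ S' x)
  C-union {S} {S'} cS cS' = C-ext (C-compl (C-inter (C-compl cS) (C-compl cS'))) (λ x → ∨-via-∧ (S x) (S' x))

-- Let U ∈ P consist of rows lying in Q
-- and V ∈ Q of columns whose complements lie in P.  Alternately choose a row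
-- a k and a column b k, shrinking the candidate sets so that later columns
-- lie in the rows of earlier a's and later rows avoid the earlier b's.
module CrossedLadder {X Y : Set} (R : X → Y → Bool)
  {P : (X → Bool) → Set₁} {Q : (Y → Bool) → Set₁}
  (P-filter : IsFilterBase P) (Q-filter : IsFilterBase Q)
  (U : X → Bool) (U-P : P U) (rows-Q : ∀ a → U a ≡ true → Q (R a))
  (V : Y → Bool) (V-Q : Q V) (cols-P : ∀ b → V b ≡ true → P (λ x → not (R x b)))
  where
  module P = IsFilterBase P-filter
  module Q = IsFilterBase Q-filter

  record Stage : Set₁ where
    field
      rows   : X → Bool
      rows-P : P rows
      rows⊆U : ∀ a → rows a ≡ true → U a ≡ true
      cols   : Y → Bool
      cols-Q : Q cols
      cols⊆V : ∀ b → cols b ≡ true → V b ≡ true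
  open Stage

  rowPoint : Stage → X
  rowPoint s = proj₁ (P.witness (rows-P s))

  nextCols : Stage → Y → Bool
  nextCols s y = cols s y ∧ R (rowPoint s) y

  nextCols-Q : (s : Stage) → Q (nextCols s)
  nextCols-Q s = Q.meet (cols-Q s) (rows-Q _ (rows⊆U s _ (proj₂ (P.witness (rows-P s)))))

  colPoint : Stage → Y
  colPoint s = proj₁ (Q.witness (nextCols-Q s))

  next : Stage → Stage
  next s = record
    { rows   = λ x → rows s x ∧ not (R x (colPoint s))
    ; rows-P = P.meet (rows-P s) (cols-P _ (cols⊆V s _ (∧-conicalˡ _ _ (proj₂ (Q.witness (nextCols-Q s))))))
    ; rows⊆U = λ x e → rows⊆U s x (∧-conicalˡ _ _ e)
    ; cols   = nextCols s
    ; cols-Q = nextCols-Q s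
    ; cols⊆V = λ y e → cols⊆V s y (∧-conicalˡ _ _ e)
    }

  stage : ℕ → Stage
  stage zero    = record { rows = U ; rows-P = U-P ; rows⊆U = λ _ e → e
                         ; cols = V ; cols-Q = V-Q ; cols⊆V = λ _ e → e }
  stage (suc k) = next (stage k)

  ladder : ℕLadder R
  ladder = record { row = a ; col = b ; above = above ; below = below }
    where
    a : ℕ → X
    a k = rowPoint (stage k)
    b : ℕ → Y
    b k = colPoint (stage k)

    above : ∀ {k n} → k ≤ n → R (a k) (b n) ≡ true
    above {k} {n} k≤n = ∧-conicalʳ (cols (stage k) (b n)) _
      (antitone (λ m y → cols (stage (suc m)) y ≡ true) (λ m → ∧-conicalˡ _ _) k≤n
        (proj₂ (Q.witness (nextCols-Q (stage n)))))

    below : ∀ {k n} → n < k → R (a k) (b n) ≡ false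
    below {k} {n} n<k = not-injective (∧-conicalʳ (rows (stage n) (a k)) _
      (antitone (λ m x → rows (stage m) x ≡ true) (λ m → ∧-conicalˡ _ _) n<k
        (proj₂ (P.witness (rows-P (stage k))))))

module _ {𝔾 : PGroup} {𝓒 p : Family 𝔾} (p-type : IsType 𝔾 𝓒 p) where
  open IsType p-type

  type-decides : ∀ {S T} → 𝓒 S → S ≗ T → p T ⊎ p (λ y → not (T y))
  type-decides cS S≗T with ty-complete cS
  ... | inj₁ pS  = inj₁ (ty-ext pS S≗T)
  ... | inj₂ p∁S = inj₂ (ty-ext p∁S (cong not ∘ S≗T))

  type-member : ∀ {S} → 𝓒 S → ¬ p (∁ 𝔾 S) → p S
  type-member cS ¬p∁S with ty-complete cS
  ... | inj₁ pS  = pS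
  ... | inj₂ p∁S = ⊥-elim (¬p∁S p∁S)

  type-∁ : ∀ {S T} → 𝓒 S → S ≗ T → ¬ p S → p (λ y → not (T y))
  type-∁ cS S≗T ¬pS with type-decides cS S≗T
  ... | inj₁ pT  = ⊥-elim (¬pS (ty-ext pT (sym ∘ S≗T)))
  ... | inj₂ p∁T = p∁T

module Classical (em : ExcludedMiddle (Level.suc 0ℓ)) where

  decide₁ : (P : Set₁) → Dec P
  decide₁ P = em

  decide : (P : Set) → Dec P
  decide P = map′ lower lift em

  byContradiction₁ : {P : Set₁} → ¬ ¬ P → P
  byContradiction₁ = em⇒dne em

  byContradiction : {P : Set} → ¬ ¬ P → P
  byContradiction {P} = decidable-stable (decide P)

  χ : {X : Set} → (X → Set) → X → Bool
  χ Q x = isYes (decide (Q x))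

  χ₁ : {X : Set} → (X → Set₁) → X → Bool
  χ₁ Q x = isYes (decide₁ (Q x))

  typeFilterBase : {𝔾 : PGroup} {𝓒 p : Family 𝔾} → IsType 𝔾 𝓒 p → 𝓒 (∁ 𝔾 (∅ 𝔾)) → IsFilterBase p
  typeFilterBase {𝔾} {𝓒} {p} p-type 𝓒-full = record
    { full = type-member p-type 𝓒-full ty-nonempty ; meet = ty-inter ; witness = witness }
    where
    open IsType p-type
    witness : ∀ {S} → p S → Σ (PGroup.Carrier 𝔾) λ y → S y ≡ true
    witness pS = byContradiction λ empty → ty-nonempty (ty-ext pS (λ y → ¬-not (λ e → empty (y , e))))

  pigeonholeℕ : {S : ℕ → Set} → Unbounded S → (c : ℕ → Bool) →
                Σ Bool λ C → Unbounded (λ n → S n × c n ≡ C)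
  pigeonholeℕ {S} unbounded c with decide (Unbounded (λ n → S n × c n ≡ true))
  ... | yes trueUnbounded  = true , trueUnbounded
  ... | no ¬trueUnbounded = false , λ m → byContradiction (¬trueUnbounded ∘ trueAbove m)
    where
    trueAbove : ∀ m → ¬ (Σ ℕ λ n → m ≤ n × S n × c n ≡ false) → Unbounded (λ n → S n × c n ≡ true)
    trueAbove m noFalse m' with unbounded (m ⊔ m')
    ... | n , m⊔m'≤n , Sn with c n in cn
    ...   | true  = n , ≤-trans (m≤n⊔m m m') m⊔m'≤n , Sn , cn
    ...   | false = ⊥-elim (noFalse (n , ≤-trans (m≤m⊔n m m') m⊔m'≤n , Sn , cn))

  -- Ramsey's theorem for 2-colourings of pairs: a sequence of heads of
  -- shrinking unbounded reservoirs, where each reservoir keeps the points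
  -- above the previous head that share one colour with it.
  module Ramsey (c : ℕ → ℕ → Bool) where
    record Reservoir : Set₁ where
      field
        member    : ℕ → Set
        unbounded : Unbounded member
    open Reservoir

    head : Reservoir → ℕ
    head r = proj₁ (unbounded r 0)

    head-member : (r : Reservoir) → member r (head r)
    head-member r = proj₂ (proj₂ (unbounded r 0))

    aboveHead : (r : Reservoir) → Unbounded (λ n → member r n × head r < n)
    aboveHead r m with unbounded r (suc (m ⊔ head r))
    ... | n , lt , inR = n , ≤-trans (m≤m⊔n m (head r)) (<⇒≤ lt) , inR , ≤-trans (s≤s (m≤n⊔m m (head r))) lt

    split : (r : Reservoir) → Σ Bool λ C → Unbounded (λ n → (member r n × head r < n) × c (head r) n ≡ C)
    split r = pigeonholeℕ (aboveHead r) (c (head r))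

    next : Reservoir → Reservoir
    next r = record { member = λ n → (member r n × head r < n) × c (head r) n ≡ proj₁ (split r)
                    ; unbounded = proj₂ (split r) }

    stage : ℕ → Reservoir
    stage zero    = record { member = λ _ → ⊤ ; unbounded = λ m → m , ≤-refl , tt }
    stage (suc k) = next (stage k)

    point : ℕ → ℕ
    point k = head (stage k)

    pointColour : ℕ → Bool
    pointColour k = proj₁ (split (stage k))

    -- every later point lies in the reservoir built after an earlier one
    later : ∀ {i j} → i < j → point i < point j × c (point i) (point j) ≡ pointColour i
    later {i} {j} i<j with antitone (λ k n → member (stage k) n) (λ k → proj₁ ∘ proj₁) i<j (head-member (stage j))
    ... | (_ , lt) , colour = lt , colour

    monochromatic : Σ (ℕ → ℕ) λ h → h Preserves _<_ ⟶ _<_ × Σ Bool λ C → ∀ {i j} → i < j → c (h i) (h j) ≡ C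
    monochromatic with pigeonholeℕ {S = λ _ → ⊤} (λ m → m , ≤-refl , tt) pointColour
    ... | C , sameColour with enumerate sameColour
    ...   | g , g-mono , g-colour =
      point ∘ g , (λ i<j → proj₁ (later (g-mono i<j))) ,
      C , λ {i} i<j → trans (proj₂ (later (g-mono i<j))) (proj₂ (g-colour i))

  ramsey : (c : ℕ → ℕ → Bool) →
           Σ (ℕ → ℕ) λ h → h Preserves _<_ ⟶ _<_ × Σ Bool λ C → ∀ {i j} → i < j → c (h i) (h j) ≡ C
  ramsey c = Ramsey.monochromatic c

  -- Twin rows: if u k and u' k are separated by every column v n with k ≤ n
  -- and agree on every v n with n < k, then R or its complement has a ladder
  -- (a monochromatic subsequence fixes the values below the diagonal).
  twinsLadder : {X Y : Set} (R : X → Y → Bool) (u u' : ℕ → X) (v : ℕ → Y) →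
    (∀ {k n} → k ≤ n → R (u k) (v n) ≡ true × R (u' k) (v n) ≡ false) →
    (∀ {k n} → n < k → R (u k) (v n) ≡ R (u' k) (v n)) →
    ¬ NoLadder R
  twinsLadder R u u' v separated agree (noLadder , noCoLadder) with ramsey (λ n k → R (u k) (v n))
  ... | h , h-mono , false , below = noLadder record
    { row = u ∘ h ; col = v ∘ h ; below = below
    ; above = λ k≤n → proj₁ (separated (increasing⇒monotone h-mono k≤n)) }
  ... | h , h-mono , true , below = noCoLadder record
    { row = u' ∘ h ; col = v ∘ h
    ; above = λ k≤n → cong not (proj₂ (separated (increasing⇒monotone h-mono k≤n)))
    ; below = λ n<k → cong not (trans (sym (agree (h-mono n<k))) (below n<k)) }

  module FiniteSupport {X Y : Set} (R : X → Y → Bool) {P : (Y → Bool) → Set₁}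
    (P-filter : IsFilterBase P) (P-decides : ∀ x → P (R x) ⊎ P (λ y → not (R x y)))
    (noLadder : NoLadder R) where
    open IsFilterBase P-filter

    Supports : List Y → Set₁
    Supports F = ∀ x x' → Agree R F x x' → P (R x) → P (R x')

    record Counterexample (F : List Y) : Set₁ where
      field
        inside outside : X
        agree          : Agree R F inside outside
        inside-P       : P (R inside)
        outside-¬P     : ¬ P (R outside)

      outside-∁P : P (λ y → not (R outside y))
      outside-∁P with P-decides outside
      ... | inj₁ pOut  = ⊥-elim (outside-¬P pOut)
      ... | inj₂ p∁Out = p∁Out

    counterexample : ∀ {F} → ¬ Supports F → Counterexample F
    counterexample unsupported = byContradiction₁ λ none → unsupported λ x x' agree px →
      byContradiction₁ λ ¬px' → none record
        { inside = x ; outside = x' ; agree = agree ; inside-P = px ; outside-¬P = ¬px' }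

    -- Without finite support: columns b k, each separating the k-th
    -- counterexample, which is taken against the columns chosen before.
    module Twins (unsupported : ∀ F → ¬ Supports F) where
      record Stage : Set₁ where
        field
          chosen       : List Y
          candidates   : Y → Bool
          candidates-P : P candidates
      open Stage

      cex : (s : Stage) → Counterexample (chosen s)
      cex s = counterexample (unsupported (chosen s))

      separating : Stage → Y → Bool
      separating s y = candidates s y ∧ (R inside y ∧ not (R outside y))
        where open Counterexample (cex s)

      separating-P : (s : Stage) → P (separating s)
      separating-P s = meet (candidates-P s) (meet inside-P outside-∁P)
        where open Counterexample (cex s)

      column : Stage → Y
      column s = proj₁ (witness (separating-P s))

      next : Stage → Stage
      next s = record { chosen = column s ∷ chosen s ; candidates = separating s ; candidates-P = separating-P s }

      stage : ℕ → Stage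
      stage zero    = record { chosen = [] ; candidates = λ _ → true ; candidates-P = full }
      stage (suc k) = next (stage k)

      x x' : ℕ → X
      x  k = Counterexample.inside  (cex (stage k))
      x' k = Counterexample.outside (cex (stage k))

      b : ℕ → Y
      b k = column (stage k)

      separated : ∀ {k n} → k ≤ n → R (x k) (b n) ≡ true × R (x' k) (b n) ≡ false
      separated {k} {n} k≤n with ∧-true (R (x k) (b n)) _ (∧-conicalʳ (candidates (stage k) (b n)) _
        (antitone (λ m y → candidates (stage (suc m)) y ≡ true) (λ m → ∧-conicalˡ _ _) k≤n
          (proj₂ (witness (separating-P (stage n))))))
      ... | inRow , notInRow' = inRow , not-injective notInRow'

      agreeBelow : ∀ {k n} → n < k → R (x k) (b n) ≡ R (x' k) (b n)
      agreeBelow {k} n<k = lookup (≤⇒≤′ n<k) (Counterexample.agree (cex (stage k)))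
        where
        lookup : ∀ {m n z z'} → suc n ≤′ m → Agree R (chosen (stage m)) z z' → R z (b n) ≡ R z' (b n)
        lookup ≤′-refl         (e ∷ _) = e
        lookup (≤′-step n<m) (_ ∷ a) = lookup n<m a

      impossible : ⊥
      impossible = twinsLadder R x x' b separated agreeBelow noLadder

    finiteSupport : Σ (List Y) Supports
    finiteSupport = byContradiction₁ λ none → Twins.impossible (λ F supports → none (F , supports))

  module Combination {X Y : Set} (R : X → Y → Bool) {C : (X → Bool) → Set₁}
    (C-field : IsFieldOfSets C) (C-col : ∀ y → C (λ x → R x y)) where
    open IsFieldOfSets C-field

    Invariant : List Y → (X → Bool) → Set
    Invariant F f = ∀ x x' → Agree R F x x' → f x ≡ true → f x' ≡ true

    invariant⇒combination : ∀ F f → Invariant F f → C f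
    invariant⇒combination [] f inv with decide (Σ X λ x → f x ≡ true)
    ... | yes (x₀ , fx₀) = C-ext (C-compl C-empty) (λ x → sym (inv x₀ x [] fx₀))
    ... | no ¬∃ = C-ext C-empty (λ x → sym (¬-not (λ fx → ¬∃ (x , fx))))
    invariant⇒combination (y ∷ F) f inv =
      C-ext (C-union (C-inter (C-col y) (part true)) (C-inter (C-compl (C-col y)) (part false))) recombine
      where
      Reach : Bool → X → Set
      Reach β x = Σ X λ z → Agree R F x z × R z y ≡ β × f z ≡ true

      reach : ∀ {β x} → (χ (Reach β) x ≡ true) ⇔ Reach β x
      reach {β} {x} = isYes⇔ (decide (Reach β x))

      part : ∀ β → C (χ (Reach β))
      part β = invariant⇒combination F (χ (Reach β)) λ x x' xx' r →
        let (z , xz , zβ , fz) = Equivalence.to reach r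
        in Equivalence.from reach (z , agree-trans R (agree-sym R xx') xz , zβ , fz)

      part-agrees : ∀ β x → R x y ≡ β → χ (Reach β) x ≡ f x
      part-agrees β x xβ = bool-ext
        (λ r → let (z , xz , zβ , fz) = Equivalence.to reach r
               in inv z x (trans zβ (sym xβ) ∷ agree-sym R xz) fz)
        (λ fx → Equivalence.from reach (x , agree-refl R F x , xβ , fx))

      recombine : ∀ x → (R x y ∧ χ (Reach true) x) ∨ (not (R x y) ∧ χ (Reach false) x) ≡ f x
      recombine x with R x y in xy
      ... | true  = trans (∨-identityʳ _) (part-agrees true x xy)
      ... | false = part-agrees false x xy

  definable : {X Y : Set} (R : X → Y → Bool) {P : (Y → Bool) → Set₁} →
    IsFilterBase P → (∀ x → P (R x) ⊎ P (λ y → not (R x y))) → NoLadder R →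
    {C : (X → Bool) → Set₁} → IsFieldOfSets C → (∀ y → C (λ x → R x y)) →
    Σ (X → Bool) λ D → (∀ x → (D x ≡ true) ⇔ P (R x)) × C D
  definable {X} {Y} R {P} P-filter P-decides noLadder C-field C-col =
    D , D⇔ , invariant⇒combination F D invariant
    where
    open FiniteSupport R P-filter P-decides noLadder using (finiteSupport)
    open Combination R C-field C-col using (Invariant; invariant⇒combination)

    D : X → Bool
    D = χ₁ (λ x → P (R x))

    D⇔ : ∀ x → (D x ≡ true) ⇔ P (R x)
    D⇔ x = isYes⇔ (decide₁ (P (R x)))

    F : List Y
    F = proj₁ finiteSupport

    invariant : Invariant F D
    invariant x x' xx' Dx =
      Equivalence.from (D⇔ x') (proj₂ finiteSupport x x' xx' (Equivalence.to (D⇔ x) Dx))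

  module Theorem (𝔾 : PGroup) (𝓑 : Family 𝔾) (𝓑-algebra : IsBooleanAlgebra 𝔾 𝓑)
    (𝓑-left : LeftInvariant 𝔾 𝓑) (𝓑-stable : ∀ {A} → 𝓑 A → Stable 𝔾 A)
    (A : Subset 𝔾) (A∈𝓑 : 𝓑 A) where
    open PGroup 𝔾 renaming (Carrier to G)
    open IsBooleanAlgebra 𝓑-algebra

    R : G → G → Bool
    R x y = A (x ∙ y)

    inverse-involutive : ∀ x → (x ⁻¹) ⁻¹ ≡ x
    inverse-involutive = ⁻¹-involutive (record { Carrier = G ; _≈_ = _≡_ ; _∙_ = _∙_ ; ε = ε ; _⁻¹ = _⁻¹ ; isGroup = isGroup })

    row-translate : ∀ x → _·ˡ_ 𝔾 (x ⁻¹) A ≗ R x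
    row-translate x y = cong (λ g → A (g ∙ y)) (inverse-involutive x)

    col-translate : ∀ y → _·ʳ_ 𝔾 A (y ⁻¹) ≗ λ x → R x y
    col-translate y x = cong (λ g → A (x ∙ g)) (inverse-involutive y)

    row∈𝓑 : ∀ x → 𝓑 (_·ˡ_ 𝔾 (x ⁻¹) A)
    row∈𝓑 x = 𝓑-left (x ⁻¹) A∈𝓑

    col∈𝓑♯ : ∀ y → Sharp 𝔾 𝓑 (_·ʳ_ 𝔾 A (y ⁻¹))
    col∈𝓑♯ y = right (y ⁻¹) (base A∈𝓑)

    𝓑-field : IsFieldOfSets 𝓑
    𝓑-field = record { C-ext = ba-ext ; C-empty = ba-empty ; C-compl = ba-compl ; C-inter = ba-inter }

    𝓑♯-field : IsFieldOfSets (Sharp 𝔾 𝓑)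
    𝓑♯-field = record { C-ext = ext ; C-empty = empty ; C-compl = compl ; C-inter = inter }

    ladder⇒unstable : ∀ {S} → ℕLadder (λ x y → S (x ∙ y)) → Ladder 𝔾 S
    ladder⇒unstable L = ℕ , _≤_ , ≤-isTotalOrder , ℕ-infinite , row , col , pattern-iff
      where open ℕLadder L

    ladderᵀ⇒unstable : ∀ {S} → ℕLadder (λ x y → S (y ∙ x)) → Ladder 𝔾 S
    ladderᵀ⇒unstable L = ℕ , flip _≤_ , Flip.isTotalOrder ≤-isTotalOrder , ℕ-infinite , col , row ,
      λ i j → pattern-iff j i
      where open ℕLadder L

    noLadder : NoLadder R
    noLadder = (λ L → 𝓑-stable A∈𝓑 (ladder⇒unstable {S = A} L))
             , (λ L → 𝓑-stable (ba-compl A∈𝓑) (ladder⇒unstable {S = ∁ 𝔾 A} L))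

    noLadderᵀ : NoLadder (flip R)
    noLadderᵀ = (λ L → 𝓑-stable A∈𝓑 (ladderᵀ⇒unstable {S = A} L))
              , (λ L → 𝓑-stable (ba-compl A∈𝓑) (ladderᵀ⇒unstable {S = ∁ 𝔾 A} L))

    viaRow : ∀ {p : Family 𝔾} → (∀ {S T} → p S → S ≗ T → p T) → ∀ x → p (R x) ⇔ d 𝔾 p A x
    viaRow p-ext x = mk⇔ (λ pR → p-ext pR (sym ∘ row-translate x)) (λ pd → p-ext pd (row-translate x))

    viaCol : ∀ {p : Family 𝔾} → (∀ {S T} → p S → S ≗ T → p T) → ∀ y → p (flip R y) ⇔ d* 𝔾 p A y
    viaCol p-ext y = mk⇔ (λ pC → p-ext pC (sym ∘ col-translate y)) (λ pd → p-ext pd (col-translate y))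

    partA : (p : Family 𝔾) → IsType 𝔾 𝓑 p →
      Σ (Subset 𝔾) λ D → Represents 𝔾 D (d 𝔾 p A) × Sharp 𝔾 𝓑 D
    partA p p-type =
      let (D , D⇔ , D∈𝓑♯) = definable R (typeFilterBase p-type (ba-compl ba-empty))
                              (λ x → type-decides p-type (row∈𝓑 x) (row-translate x)) noLadder
                              𝓑♯-field (λ y → ext (col∈𝓑♯ y) (col-translate y))
      in D , (λ x → ⇔.trans (D⇔ x) (viaRow (IsType.ty-ext p-type) x)) , D∈𝓑♯

    partB : (p : Family 𝔾) → IsType 𝔾 (Sharp 𝔾 𝓑) p →
      Σ (Subset 𝔾) λ E → Represents 𝔾 E (d* 𝔾 p A) × 𝓑 E
    partB p p-type =
      let (E , E⇔ , E∈𝓑) = definable (flip R) (typeFilterBase p-type (compl empty))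
                             (λ x → type-decides p-type (col∈𝓑♯ x) (col-translate x)) noLadderᵀ
                             𝓑-field (λ y → ba-ext (row∈𝓑 y) (row-translate y))
      in E , (λ x → ⇔.trans (E⇔ x) (viaCol (IsType.ty-ext p-type) x)) , E∈𝓑

    -- (c) dq(A) ∈ p iff dp*(A) ∈ q.  In each direction, if the other side
    -- failed, the two types would cross and build a ladder of R or of ¬R.
    partC : (p q : Family 𝔾) → IsType 𝔾 (Sharp 𝔾 𝓑) p → IsType 𝔾 𝓑 q →
      (Σ (Subset 𝔾) λ D → Represents 𝔾 D (d 𝔾 q A) × p D)
        ⇔ (Σ (Subset 𝔾) λ E → Represents 𝔾 E (d* 𝔾 p A) × q E)
    partC p q p-type q-type = mk⇔ toE toD
      where
      module p = IsType p-type
      module q = IsType q-type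

      p-filter : IsFilterBase p
      p-filter = typeFilterBase p-type (compl empty)

      q-filter : IsFilterBase q
      q-filter = typeFilterBase q-type (ba-compl ba-empty)

      outside : ∀ {S : Subset 𝔾} {Φ : G → Set₁} → Represents 𝔾 S Φ → ∀ z → not (S z) ≡ true → ¬ Φ z
      outside S⇔ z notSz Φz = not-¬ (Equivalence.from (S⇔ z) Φz) (not-injective notSz)

      crossing : ∀ {D E} → Represents 𝔾 D (d 𝔾 q A) → p D → Represents 𝔾 E (d* 𝔾 p A) → ¬ q (∁ 𝔾 E)
      crossing D⇔ pD E⇔ q∁E = proj₁ noLadder (CrossedLadder.ladder R p-filter q-filter
        _ pD (λ a Da → Equivalence.from (viaRow q.ty-ext a) (Equivalence.to (D⇔ a) Da))
        _ q∁E (λ b ∁Eb → type-∁ p-type (col∈𝓑♯ b) (col-translate b) (outside E⇔ b ∁Eb)))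

      coCrossing : ∀ {D E} → Represents 𝔾 E (d* 𝔾 p A) → q E → Represents 𝔾 D (d 𝔾 q A) → ¬ p (∁ 𝔾 D)
      coCrossing E⇔ qE D⇔ p∁D = proj₂ noLadder (CrossedLadder.ladder (λ x y → not (R x y)) p-filter q-filter
        _ p∁D (λ a ∁Da → type-∁ q-type (row∈𝓑 a) (row-translate a) (outside D⇔ a ∁Da))
        _ qE (λ b Eb → p.ty-ext (Equivalence.to (E⇔ b) Eb)
                         (λ x → trans (col-translate b x) (sym (not-involutive _)))))

      toE : (Σ (Subset 𝔾) λ D → Represents 𝔾 D (d 𝔾 q A) × p D) →
            (Σ (Subset 𝔾) λ E → Represents 𝔾 E (d* 𝔾 p A) × q E)
      toE (D , D⇔ , pD) =
        let (E , E⇔ , E∈𝓑) = partB p p-type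
        in E , E⇔ , type-member q-type E∈𝓑 (crossing D⇔ pD E⇔)

      toD : (Σ (Subset 𝔾) λ E → Represents 𝔾 E (d* 𝔾 p A) × q E) →
            (Σ (Subset 𝔾) λ D → Represents 𝔾 D (d 𝔾 q A) × p D)
      toD (E , E⇔ , qE) =
        let (D , D⇔ , D∈𝓑♯) = partA q q-type
        in D , D⇔ , type-member p-type D∈𝓑♯ (coCrossing E⇔ qE D⇔)

lemma4p3 : ExcludedMiddle (Level.suc 0ℓ) →
    (𝔾 : PGroup) (𝓑 : Family 𝔾) →
    IsBooleanAlgebra 𝔾 𝓑 → LeftInvariant 𝔾 𝓑 →
    (∀ {A} → 𝓑 A → Stable 𝔾 A) →
    (A : Subset 𝔾) → 𝓑 A →
    ((p : Family 𝔾) → IsType 𝔾 𝓑 p →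
      Σ (Subset 𝔾) λ D → Represents 𝔾 D (d 𝔾 p A) × Sharp 𝔾 𝓑 D)
    × ((p : Family 𝔾) → IsType 𝔾 (Sharp 𝔾 𝓑) p →
      Σ (Subset 𝔾) λ E → Represents 𝔾 E (d* 𝔾 p A) × 𝓑 E)
    × ((p q : Family 𝔾) → IsType 𝔾 (Sharp 𝔾 𝓑) p → IsType 𝔾 𝓑 q →
      (Σ (Subset 𝔾) λ D → Represents 𝔾 D (d 𝔾 q A) × p D)
        ⇔ (Σ (Subset 𝔾) λ E → Represents 𝔾 E (d* 𝔾 p A) × q E))
lemma4p3 em 𝔾 𝓑 𝓑-algebra 𝓑-left 𝓑-stable A A∈𝓑 = partA , partB , partC
  where open Classical.Theorem em 𝔾 𝓑 𝓑-algebra 𝓑-left 𝓑-stable A A∈𝓑
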